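{- Let $n\ge 1$ and let $D\subseteq S_n$ be a nonempty $1$-design in $(S_n,d_S)$. Then the covering radius of $D$ satisfies $\rho(D)\le n-1$.
   Context: $S_n$ is the symmetric group on $n$ letters with the metric $d_S(\sigma,\theta)=n-F(\sigma\theta^{ -1})$, where $F(\nu)$ is the number of fixed points of $\nu$. For $0\le i\le n$ let $E_i=\{(x,y)\in S_n^2: d_S(x,y)=i\}$, and let $w_k$ be the number of permutations of $n$ letters with exactly $k$ fixed points; put $v_j=w_{n-j}$. For a nonempty $D\subseteq S_n$, its frequencies are $f_i=|D^2\cap E_i|/|D|^2$ (with $D^2$ the set of ordered pairs). $D$ is a $t$-design if $\sum_{j=0}^n f_j j^i=\sum_{j=0}^n \frac{v_j}{n!}j^i$ for all $i=1,\dots,t$. The covering radius is $\rho(D)=\max_{x\in S_n}\min_{y\in D} d_S(x,y)$. -}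

module Defs where

open import Data.Nat as ℕ using (ℕ; zero; suc; _∸_; _⊔_; _⊓_; _^_)

open import Data.Fin using (Fin; zero; suc; _≟_)
open import Data.Vec using (Vec; []; _∷_; lookup; tabulate; toList)
open import Data.List using (List; []; _∷_; map; filter; length; foldr; upTo; allFin; concatMap; cartesianProduct)
open import Data.List.Relation.Unary.Unique.Propositional using (Unique)
import Data.List.Relation.Unary.Unique.DecPropositional as UDec
open import Data.Product using (_×_; _,_)
open import Data.Integer using (+_)
open import Data.Rational as ℚ using (ℚ; _/_; 0ℚ)
open import Relation.Binary.PropositionalEquality using (_≡_)
open import Relation.Nullary using (yes; no; does)
open import Data.Bool using (Bool; true; false)

-- A permutation of n letters is represented by its one-line notation:
-- a vector σ with σ[i] = σ(i), whose entries are pairwise distinct.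
Vecₙ : ℕ → Set
Vecₙ n = Vec (Fin n) n

IsPerm : ∀ {n} → Vecₙ n → Set
IsPerm σ = Unique (toList σ)

allVecs : (n k : ℕ) → List (Vec (Fin n) k)
allVecs n zero = [] ∷ []
allVecs n (suc k) = concatMap (λ i → map (i ∷_) (allVecs n k)) (allFin n)

Sym : (n : ℕ) → List (Vecₙ n)
Sym n = filter (λ σ → UDec.unique? _≟_ (toList σ)) (allVecs n n)

private
  findIdx : ∀ {n} → Vecₙ n → Fin n → List (Fin n) → Fin n → Fin n
  findIdx σ i [] def = def
  findIdx σ i (j ∷ js) def with lookup σ j ≟ i
  ... | yes _ = j
  ... | no _  = findIdx σ i js def

inv : ∀ {n} → Vecₙ n → Vecₙ n
inv {n} θ = tabulate (λ i → findIdx θ i (allFin n) i)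

_∘ₚ_ : ∀ {n} → Vecₙ n → Vecₙ n → Vecₙ n
σ ∘ₚ θ = tabulate (λ i → lookup σ (lookup θ i))

F : ∀ {n} → Vecₙ n → ℕ
F {n} ν = length (filter (λ i → lookup ν i ≟ i) (allFin n))

dS : ∀ {n} → Vecₙ n → Vecₙ n → ℕ
dS {n} σ θ = n ∸ F (σ ∘ₚ inv θ)

w : (n k : ℕ) → ℕ
w n k = length (filter (λ σ → F σ ℕ.≟ k) (Sym n))

v : (n j : ℕ) → ℕ
v n j = w n (n ∸ j)

-- a/b as a rational (b = 0 never occurs in uses below)
frac : ℕ → ℕ → ℚ
frac a zero = 0ℚ
frac a (suc b) = (+ a) / suc b

freq : ∀ {n} → List (Vecₙ n) → ℕ → ℚ
freq D i = frac (length (filter (λ p → dS (Data.Product.proj₁ p) (Data.Product.proj₂ p) ℕ.≟ i)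
                                 (cartesianProduct D D)))
                (length D ℕ.* length D)

sumℚ : List ℚ → ℚ
sumℚ = foldr ℚ._+_ 0ℚ

IsDesign : ∀ {n} → ℕ → List (Vecₙ n) → Set
IsDesign {n} t D = ∀ i → 1 ℕ.≤ i → i ℕ.≤ t →
  sumℚ (map (λ j → freq D j ℚ.* frac (j ^ i) 1) (upTo (suc n)))
    ≡ sumℚ (map (λ j → frac (v n j) (n ℕ.!) ℚ.* frac (j ^ i) 1) (upTo (suc n)))

-- covering radius ρ(D) = max_{x ∈ S_n} min_{y ∈ D} d_S(x,y)
-- (min over D computed with initial value n, an upper bound of d_S; D nonempty)
coveringRadius : ∀ {n} → List (Vecₙ n) → ℕ
coveringRadius {n} D = foldr _⊔_ 0 (map (λ x → foldr _⊓_ n (map (λ y → dS x y) D)) (Sym n))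

-- Write k = |D| and, for a position i and a value a, let c(i, a) be the number of θ ∈ D with θ i = a.
-- Since n − d_S(σ, θ) counts the positions where σ and θ agree and a uniform permutation has one
-- fixed point on average, the 1-design condition says that the total number of agreements between
-- ordered pairs of D is k². That total is Σᵢ Σₐ c(i, a)², and by Cauchy–Schwarz each inner sum is at
-- least k²/n, strictly more if some c(i, a) vanishes. So every value occurs at position 0 in D:
-- every permutation agrees with some member of D in at least one position, i.e. is within n − 1 of D.

module Submission where

open import Defs
open import Data.Nat using (ℕ; _≤_; _∸_)
open import Data.List using (List; [])
open import Data.List.Relation.Unary.All using (All)
open import Data.List.Relation.Unary.Unique.Propositional using (Unique)
open import Relation.Binary.PropositionalEquality using (_≢_)

open import Data.Nat as ℕ using (zero; suc; _+_; _*_; z≤n; s≤s; _!; _^_; _⊔_; _⊓_; NonZero)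
import Data.Nat.Properties as ℕₚ
open import Data.Nat.Tactic.RingSolver using (solve-∀)
open import Data.Fin as Fin using (Fin; zero; suc; punchOut)
import Data.Fin.Properties as Finₚ
open import Data.Fin.Permutation using (Permutation′; permutation; _⟨$⟩ʳ_; _⟨$⟩ˡ_; inverseˡ; inverseʳ; transpose)
import Algebra.Properties.CommutativeMonoid.Sum ℕₚ.+-0-commutativeMonoid as FinSum
open import Data.List as List using (_∷_; _++_; map; filter; length; concatMap; cartesianProduct; allFin; upTo; foldr)
import Data.List.Properties as Listₚ
open import Data.List.Membership.Propositional using (_∈_; find)
import Data.List.Membership.Propositional.Properties as ∈ₚ
open import Data.List.Relation.Unary.Any using (Any; here; there)
import Data.List.Relation.Unary.All as All
open import Data.List.Relation.Unary.AllPairs using ([]; _∷_)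
import Data.List.Relation.Unary.Unique.Propositional.Properties as Uniqueₚ
import Data.List.Relation.Unary.Unique.DecPropositional as UniqueDec
open import Data.Vec as Vec using (Vec; _∷_; lookup; toList)
import Data.Vec.Properties as Vecₚ
import Data.Integer as ℤ
import Data.Integer.Properties as ℤₚ
import Data.Rational as ℚ
open import Data.Rational using (toℚᵘ)
import Data.Rational.Properties as ℚₚ
open import Data.Rational.Unnormalised using (mkℚᵘ; *≡*) renaming (_≃_ to _≃ᵘ_)
import Data.Rational.Unnormalised as ℚᵘ
import Data.Rational.Unnormalised.Properties as ℚᵘₚ
open import Data.Product using (_×_; _,_; ∃)
open import Data.Sum using (_⊎_; inj₁; inj₂; [_,_]′)
open import Function using (_∘_; id)
open import Relation.Binary.Definitions using (DecidableEquality)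
open import Relation.Binary.PropositionalEquality using (_≡_; refl; sym; trans; cong; cong₂; subst; subst₂; module ≡-Reasoning)
open import Relation.Nullary using (Dec; yes; no; ¬_)
open import Relation.Nullary.Decidable using (_×-dec_)
open import Relation.Nullary.Negation using (contradiction)
open import Relation.Unary using (Decidable)

𝟙[_] : ∀ {p} {P : Set p} → Dec P → ℕ
𝟙[ yes _ ] = 1
𝟙[ no _ ] = 0

module _ {p} {P : Set p} where

  𝟙≤1 : (P? : Dec P) → 𝟙[ P? ] ≤ 1
  𝟙≤1 (yes _) = s≤s z≤n
  𝟙≤1 (no _) = z≤n

  𝟙-yes : (P? : Dec P) → P → 𝟙[ P? ] ≡ 1
  𝟙-yes (yes _) _ = refl
  𝟙-yes (no ¬p) p = contradiction p ¬p

  𝟙-no : (P? : Dec P) → ¬ P → 𝟙[ P? ] ≡ 0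
  𝟙-no (yes p) ¬p = contradiction p ¬p
  𝟙-no (no _) _ = refl

  𝟙-cong : ∀ {q} {Q : Set q} (P? : Dec P) (Q? : Dec Q) → (P → Q) → (Q → P) → 𝟙[ P? ] ≡ 𝟙[ Q? ]
  𝟙-cong (yes _) (yes _) _ _ = refl
  𝟙-cong (yes p) (no ¬q) to _ = contradiction (to p) ¬q
  𝟙-cong (no ¬p) (yes q) _ from = contradiction (from q) ¬p
  𝟙-cong (no _) (no _) _ _ = refl

  𝟙-×-dec : ∀ {q} {Q : Set q} (P? : Dec P) (Q? : Dec Q) → 𝟙[ P? ×-dec Q? ] ≡ 𝟙[ P? ] * 𝟙[ Q? ]
  𝟙-×-dec (yes _) (yes _) = refl
  𝟙-×-dec (yes _) (no _) = refl
  𝟙-×-dec (no _) _ = refl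

  *-𝟙-cong : ∀ {a b} (P? : Dec P) → (P → a ≡ b) → a * 𝟙[ P? ] ≡ b * 𝟙[ P? ]
  *-𝟙-cong (yes p) a≡b = cong (_* 1) (a≡b p)
  *-𝟙-cong {a} {b} (no _) _ = trans (ℕₚ.*-zeroʳ a) (sym (ℕₚ.*-zeroʳ b))

𝟙-≟-sym : ∀ {a} {A : Set a} (_≟_ : DecidableEquality A) x y → 𝟙[ x ≟ y ] ≡ 𝟙[ y ≟ x ]
𝟙-≟-sym _≟_ x y = 𝟙-cong (x ≟ y) (y ≟ x) sym sym

∑ : ∀ {a} {A : Set a} → List A → (A → ℕ) → ℕ
∑ [] f = 0
∑ (x ∷ xs) f = f x + ∑ xs f

infix 2 ∑
syntax ∑ xs (λ x → e) = ∑[ x ∈ xs ] e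

module _ {a} {A : Set a} where

  ∑-cong : ∀ (xs : List A) {f g : A → ℕ} → (∀ x → f x ≡ g x) → ∑ xs f ≡ ∑ xs g
  ∑-cong [] _ = refl
  ∑-cong (x ∷ xs) f≗g = cong₂ _+_ (f≗g x) (∑-cong xs f≗g)

  ∑-cong-∈ : ∀ (xs : List A) {f g : A → ℕ} → (∀ {x} → x ∈ xs → f x ≡ g x) → ∑ xs f ≡ ∑ xs g
  ∑-cong-∈ [] _ = refl
  ∑-cong-∈ (x ∷ xs) f≗g = cong₂ _+_ (f≗g (here refl)) (∑-cong-∈ xs (f≗g ∘ there))

  ∑-mono-≤ : ∀ (xs : List A) {f g : A → ℕ} → (∀ x → f x ≤ g x) → ∑ xs f ≤ ∑ xs g
  ∑-mono-≤ [] _ = z≤n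
  ∑-mono-≤ (x ∷ xs) f≤g = ℕₚ.+-mono-≤ (f≤g x) (∑-mono-≤ xs f≤g)

  ∑-distrib-+ : ∀ (xs : List A) (f g : A → ℕ) → (∑[ x ∈ xs ] f x + g x) ≡ ∑ xs f + ∑ xs g
  ∑-distrib-+ [] f g = refl
  ∑-distrib-+ (x ∷ xs) f g = begin
    f x + g x + (∑[ y ∈ xs ] f y + g y)  ≡⟨ cong (f x + g x +_) (∑-distrib-+ xs f g) ⟩
    f x + g x + (∑ xs f + ∑ xs g)        ≡⟨ interchange (f x) (g x) (∑ xs f) (∑ xs g) ⟩
    f x + ∑ xs f + (g x + ∑ xs g)        ∎
    where
    open ≡-Reasoning
    interchange : ∀ a b c d → a + b + (c + d) ≡ a + c + (b + d)
    interchange = solve-∀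

  ∑-*ˡ : ∀ (xs : List A) c (f : A → ℕ) → (∑[ x ∈ xs ] c * f x) ≡ c * ∑ xs f
  ∑-*ˡ [] c f = sym (ℕₚ.*-zeroʳ c)
  ∑-*ˡ (x ∷ xs) c f = trans (cong (c * f x +_) (∑-*ˡ xs c f)) (sym (ℕₚ.*-distribˡ-+ c (f x) (∑ xs f)))

  ∑-*ʳ : ∀ (xs : List A) c (f : A → ℕ) → (∑[ x ∈ xs ] f x * c) ≡ ∑ xs f * c
  ∑-*ʳ [] c f = refl
  ∑-*ʳ (x ∷ xs) c f = trans (cong (f x * c +_) (∑-*ʳ xs c f)) (sym (ℕₚ.*-distribʳ-+ c (f x) (∑ xs f)))

  ∑-++ : ∀ (xs ys : List A) (f : A → ℕ) → ∑ (xs ++ ys) f ≡ ∑ xs f + ∑ ys f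
  ∑-++ [] ys f = refl
  ∑-++ (x ∷ xs) ys f = trans (cong (f x +_) (∑-++ xs ys f)) (sym (ℕₚ.+-assoc (f x) (∑ xs f) (∑ ys f)))

  ∑-const : ∀ (xs : List A) c → (∑[ _ ∈ xs ] c) ≡ length xs * c
  ∑-const [] c = refl
  ∑-const (x ∷ xs) c = cong (c +_) (∑-const xs c)

  ∑-1 : ∀ (xs : List A) → (∑[ _ ∈ xs ] 1) ≡ length xs
  ∑-1 xs = trans (∑-const xs 1) (ℕₚ.*-identityʳ (length xs))

  ∑-∸-complement : ∀ (xs : List A) c (f : A → ℕ) → (∀ x → f x ≤ c) →
                   (∑[ x ∈ xs ] c ∸ f x) + ∑ xs f ≡ length xs * c
  ∑-∸-complement xs c f f≤c = begin
    (∑[ x ∈ xs ] c ∸ f x) + ∑ xs f  ≡⟨ ∑-distrib-+ xs (λ x → c ∸ f x) f ⟨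
    (∑[ x ∈ xs ] c ∸ f x + f x)     ≡⟨ ∑-cong xs (λ x → ℕₚ.m∸n+n≡m (f≤c x)) ⟩
    (∑[ _ ∈ xs ] c)                 ≡⟨ ∑-const xs c ⟩
    length xs * c                   ∎
    where open ≡-Reasoning

  length-filter≡∑𝟙 : ∀ {p} {P : A → Set p} (P? : Decidable P) (xs : List A) →
                     length (filter P? xs) ≡ (∑[ x ∈ xs ] 𝟙[ P? x ])
  length-filter≡∑𝟙 P? [] = refl
  length-filter≡∑𝟙 P? (x ∷ xs) with P? x
  ... | yes _ = cong suc (length-filter≡∑𝟙 P? xs)
  ... | no _ = length-filter≡∑𝟙 P? xs

  ∑-filter : ∀ {p} {P : A → Set p} (P? : Decidable P) (xs : List A) (f : A → ℕ) →
             ∑ (filter P? xs) f ≡ (∑[ x ∈ xs ] 𝟙[ P? x ] * f x)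
  ∑-filter P? [] f = refl
  ∑-filter P? (x ∷ xs) f with P? x
  ... | yes _ = cong₂ _+_ (sym (ℕₚ.+-identityʳ (f x))) (∑-filter P? xs f)
  ... | no _ = ∑-filter P? xs f

  ∑-𝟙-≟-unique : (_≟_ : DecidableEquality A) {xs : List A} → Unique xs →
                 ∀ {x} → x ∈ xs → (∑[ y ∈ xs ] 𝟙[ x ≟ y ]) ≡ 1
  ∑-𝟙-≟-unique _≟_ {y ∷ xs} (y∉xs ∷ _) {x} (here refl) =
    cong₂ _+_ (𝟙-yes (x ≟ x) refl) (absent xs y∉xs)
    where
    absent : ∀ ys → All.All (x ≢_) ys → (∑[ z ∈ ys ] 𝟙[ x ≟ z ]) ≡ 0
    absent [] _ = refl
    absent (z ∷ zs) (x≢z All.∷ x∉zs) = cong₂ _+_ (𝟙-no (x ≟ z) x≢z) (absent zs x∉zs)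
  ∑-𝟙-≟-unique _≟_ {y ∷ xs} (y∉xs ∷ xs!) (there x∈xs) =
    cong₂ _+_ (𝟙-no (_ ≟ y) λ { refl → All.lookup y∉xs x∈xs refl }) (∑-𝟙-≟-unique _≟_ xs! x∈xs)

  ∑-𝟙-≟-pick : (_≟_ : DecidableEquality A) {xs : List A} → Unique xs →
               ∀ {x} → x ∈ xs → (f : A → ℕ) → (∑[ y ∈ xs ] 𝟙[ x ≟ y ] * f y) ≡ f x
  ∑-𝟙-≟-pick _≟_ {xs} xs! {x} x∈xs f = begin
    (∑[ y ∈ xs ] 𝟙[ x ≟ y ] * f y)  ≡⟨ ∑-cong xs at-x ⟩
    (∑[ y ∈ xs ] 𝟙[ x ≟ y ] * f x)  ≡⟨ ∑-*ʳ xs (f x) (λ y → 𝟙[ x ≟ y ]) ⟩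
    (∑[ y ∈ xs ] 𝟙[ x ≟ y ]) * f x  ≡⟨ cong (_* f x) (∑-𝟙-≟-unique _≟_ xs! x∈xs) ⟩
    1 * f x                         ≡⟨ ℕₚ.*-identityˡ (f x) ⟩
    f x                             ∎
    where
    open ≡-Reasoning
    at-x : ∀ y → 𝟙[ x ≟ y ] * f y ≡ 𝟙[ x ≟ y ] * f x
    at-x y with x ≟ y
    ... | yes refl = refl
    ... | no _ = refl

  ∑-≥-term : ∀ {xs : List A} {x} → x ∈ xs → (f : A → ℕ) → f x ≤ ∑ xs f
  ∑-≥-term {y ∷ xs} (here refl) f = ℕₚ.m≤m+n (f y) (∑ xs f)
  ∑-≥-term {y ∷ xs} (there x∈xs) f = ℕₚ.≤-trans (∑-≥-term x∈xs f) (ℕₚ.m≤n+m (∑ xs f) (f y))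

  ∑-𝟙≢0⇒Any : ∀ {p} {P : A → Set p} (P? : Decidable P) (xs : List A) → (∑[ x ∈ xs ] 𝟙[ P? x ]) ≢ 0 → Any P xs
  ∑-𝟙≢0⇒Any P? [] ∑≢0 = contradiction refl ∑≢0
  ∑-𝟙≢0⇒Any P? (x ∷ xs) ∑≢0 with P? x
  ... | yes px = here px
  ... | no _ = there (∑-𝟙≢0⇒Any P? xs ∑≢0)

  ∑-*-∑ : ∀ (xs : List A) (f g : A → ℕ) → ∑ xs f * ∑ xs g ≡ (∑[ x ∈ xs ] ∑[ y ∈ xs ] f x * g y)
  ∑-*-∑ xs f g = trans (sym (∑-*ʳ xs (∑ xs g) f)) (∑-cong xs (λ x → sym (∑-*ˡ xs (f x) g)))

∑-map : ∀ {a b} {A : Set a} {B : Set b} (xs : List A) (g : A → B) (f : B → ℕ) → ∑ (map g xs) f ≡ ∑ xs (f ∘ g)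
∑-map [] g f = refl
∑-map (x ∷ xs) g f = cong (f (g x) +_) (∑-map xs g f)

module _ {a b} {A : Set a} {B : Set b} where

  ∑-concatMap : ∀ (xs : List A) (g : A → List B) (f : B → ℕ) → ∑ (concatMap g xs) f ≡ (∑[ x ∈ xs ] ∑ (g x) f)
  ∑-concatMap [] g f = refl
  ∑-concatMap (x ∷ xs) g f = trans (∑-++ (g x) (concatMap g xs) f) (cong (∑ (g x) f +_) (∑-concatMap xs g f))

  ∑-comm : ∀ (xs : List A) (ys : List B) (f : A → B → ℕ) →
           (∑[ x ∈ xs ] ∑[ y ∈ ys ] f x y) ≡ (∑[ y ∈ ys ] ∑[ x ∈ xs ] f x y)
  ∑-comm [] ys f = sym (trans (∑-const ys 0) (ℕₚ.*-zeroʳ (length ys)))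
  ∑-comm (x ∷ xs) ys f = trans (cong (∑ ys (f x) +_) (∑-comm xs ys f)) (sym (∑-distrib-+ ys (f x) _))

  ∑-cartesianProduct : ∀ (xs : List A) (ys : List B) (f : A × B → ℕ) →
                       ∑ (cartesianProduct xs ys) f ≡ (∑[ x ∈ xs ] ∑[ y ∈ ys ] f (x , y))
  ∑-cartesianProduct [] ys f = refl
  ∑-cartesianProduct (x ∷ xs) ys f =
    trans (∑-++ (map (x ,_) ys) _ f) (cong₂ _+_ (∑-map ys (x ,_) f) (∑-cartesianProduct xs ys f))

∑-tabulate : ∀ {a} {A : Set a} {m} (h : Fin m → A) (f : A → ℕ) → ∑ (List.tabulate h) f ≡ FinSum.sum (f ∘ h)
∑-tabulate {m = zero} h f = refl
∑-tabulate {m = suc m} h f = cong (f (h zero) +_) (∑-tabulate (h ∘ suc) f)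

∑-allFin-suc : ∀ n (f : Fin (suc n) → ℕ) → ∑ (allFin (suc n)) f ≡ f zero + ∑ (allFin n) (f ∘ suc)
∑-allFin-suc n f = trans (∑-tabulate id f) (cong (f zero +_) (sym (∑-tabulate id (f ∘ suc))))

∑-allFin-permute : ∀ {n} (π : Permutation′ n) (f : Fin n → ℕ) → (∑[ i ∈ allFin n ] f (π ⟨$⟩ʳ i)) ≡ ∑ (allFin n) f
∑-allFin-permute {n} π f = begin
  (∑[ i ∈ allFin n ] f (π ⟨$⟩ʳ i))  ≡⟨ ∑-tabulate id (f ∘ (π ⟨$⟩ʳ_)) ⟩
  FinSum.sum (f ∘ (π ⟨$⟩ʳ_))         ≡⟨ FinSum.sum-permute f π ⟨
  FinSum.sum f                      ≡⟨ ∑-tabulate id f ⟨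
  ∑ (allFin n) f                    ∎
  where open ≡-Reasoning

∑-allFin-const : ∀ n c → (∑[ _ ∈ allFin n ] c) ≡ n * c
∑-allFin-const n c = trans (∑-const (allFin n) c) (cong (_* c) (Listₚ.length-tabulate {n = n} id))

∑-allFin-1 : ∀ n → (∑[ _ ∈ allFin n ] 1) ≡ n
∑-allFin-1 n = trans (∑-allFin-const n 1) (ℕₚ.*-identityʳ n)

∑-allFin-𝟙-≟ˡ : ∀ {n} (x : Fin n) → (∑[ y ∈ allFin n ] 𝟙[ x Fin.≟ y ]) ≡ 1
∑-allFin-𝟙-≟ˡ {n} x = ∑-𝟙-≟-unique Fin._≟_ (Uniqueₚ.allFin⁺ n) (∈ₚ.∈-allFin x)

∑-allFin-𝟙-≟ʳ : ∀ {n} (x : Fin n) → (∑[ y ∈ allFin n ] 𝟙[ y Fin.≟ x ]) ≡ 1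
∑-allFin-𝟙-≟ʳ {n} x = trans (∑-cong (allFin n) (λ y → 𝟙-≟-sym Fin._≟_ y x)) (∑-allFin-𝟙-≟ˡ x)

∑-allFin-pick : ∀ {n} (x : Fin n) (f : Fin n → ℕ) → (∑[ y ∈ allFin n ] 𝟙[ x Fin.≟ y ] * f y) ≡ f x
∑-allFin-pick {n} x = ∑-𝟙-≟-pick Fin._≟_ (Uniqueₚ.allFin⁺ n) (∈ₚ.∈-allFin x)

infix 8 _²
_² : ℕ → ℕ
n ² = n * n

2mn≤m²+n² : ∀ m n → 2 * (m * n) ≤ m ² + n ²
2mn≤m²+n² m n = [ ordered , swapped ]′ (ℕₚ.≤-total m n)
  where
  ordered : ∀ {m n} → m ≤ n → 2 * (m * n) ≤ m ² + n ²
  ordered {m} m≤n with d , refl ← ℕₚ.m≤n⇒∃[o]m+o≡n m≤n =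
    subst (2 * (m * (m + d)) ≤_) (square-gap m d) (ℕₚ.m≤m+n _ (d ²))
    where
    square-gap : ∀ m d → 2 * (m * (m + d)) + d * d ≡ m * m + (m + d) * (m + d)
    square-gap = solve-∀
  swapped : n ≤ m → 2 * (m * n) ≤ m ² + n ²
  swapped n≤m = subst₂ _≤_ (cong (2 *_) (ℕₚ.*-comm n m)) (ℕₚ.+-comm (n ²) (m ²)) (ordered n≤m)

-- Lagrange: expand both sides as double sums and compare the (x, y) and (y, x) terms by 2ab ≤ a² + b².
cauchy-schwarz : ∀ {a} {A : Set a} (xs : List A) (f g : A → ℕ) →
                 (∑[ x ∈ xs ] f x * g x) ² ≤ (∑[ x ∈ xs ] f x ²) * (∑[ x ∈ xs ] g x ²)
cauchy-schwarz xs f g = ℕₚ.*-cancelˡ-≤ 2 (begin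
  2 * (∑ xs fg) ²
    ≡⟨ cong (2 *_) (∑-*-∑ xs fg fg) ⟩
  2 * (∑[ x ∈ xs ] ∑[ y ∈ xs ] fg x * fg y)
    ≡⟨ ∑-*ˡ xs 2 _ ⟨
  (∑[ x ∈ xs ] 2 * (∑[ y ∈ xs ] fg x * fg y))
    ≡⟨ ∑-cong xs (λ x → ∑-*ˡ xs 2 _) ⟨
  (∑[ x ∈ xs ] ∑[ y ∈ xs ] 2 * (fg x * fg y))
    ≤⟨ ∑-mono-≤ xs (λ x → ∑-mono-≤ xs (λ y → cross-term x y)) ⟩
  (∑[ x ∈ xs ] ∑[ y ∈ xs ] Q x y + Q y x)
    ≡⟨ ∑-cong xs (λ x → ∑-distrib-+ xs (Q x) (λ y → Q y x)) ⟩
  (∑[ x ∈ xs ] ∑ xs (Q x) + (∑[ y ∈ xs ] Q y x))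
    ≡⟨ ∑-distrib-+ xs _ _ ⟩
  (∑[ x ∈ xs ] ∑ xs (Q x)) + (∑[ x ∈ xs ] ∑[ y ∈ xs ] Q y x)
    ≡⟨ cong ((∑[ x ∈ xs ] ∑ xs (Q x)) +_) (∑-comm xs xs Q) ⟨
  (∑[ x ∈ xs ] ∑ xs (Q x)) + (∑[ x ∈ xs ] ∑ xs (Q x))
    ≡⟨ cong₂ _+_ (∑-*-∑ xs f² g²) (trans (ℕₚ.+-identityʳ _) (∑-*-∑ xs f² g²)) ⟨
  2 * (∑ xs f² * ∑ xs g²) ∎)
  where
  open ℕₚ.≤-Reasoning
  fg f² g² : _ → ℕ
  fg x = f x * g x
  f² x = f x ²
  g² x = g x ²
  Q : _ → _ → ℕ
  Q x y = f² x * g² y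
  cross-term : ∀ x y → 2 * (fg x * fg y) ≤ Q x y + Q y x
  cross-term x y = subst₂ _≤_ (rearrange (f x) (g y) (f y) (g x)) (squares (f x) (g y) (f y) (g x))
                          (2mn≤m²+n² (f x * g y) (f y * g x))
    where
    rearrange : ∀ a b c d → 2 * ((a * b) * (c * d)) ≡ 2 * ((a * d) * (c * b))
    rearrange = solve-∀
    squares : ∀ a b c d → (a * b) * (a * b) + (c * d) * (c * d) ≡ (a * a) * (b * b) + (c * c) * (d * d)
    squares = solve-∀

All-toList-lookup : ∀ {a p} {A : Set a} {P : A → Set p} {m} (xs : Vec A m) → All P (toList xs) → ∀ i → P (lookup xs i)
All-toList-lookup (x ∷ xs) (px All.∷ _) zero = px
All-toList-lookup (x ∷ xs) (_ All.∷ pxs) (suc i) = All-toList-lookup xs pxs i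

lookup-injective : ∀ {a} {A : Set a} {m} (xs : Vec A m) → Unique (toList xs) →
                   ∀ i j → lookup xs i ≡ lookup xs j → i ≡ j
lookup-injective (x ∷ xs) _ zero zero _ = refl
lookup-injective (x ∷ xs) (x∉xs ∷ _) zero (suc j) eq = contradiction eq (All-toList-lookup xs x∉xs j)
lookup-injective (x ∷ xs) (x∉xs ∷ _) (suc i) zero eq = contradiction (sym eq) (All-toList-lookup xs x∉xs i)
lookup-injective (x ∷ xs) (_ ∷ xs!) (suc i) (suc j) eq = cong suc (lookup-injective xs xs! i j eq)

-- A value missed by σ would let punchOut inject Fin (suc m) into Fin m.
lookup-surjective : ∀ {n} (σ : Vecₙ n) → IsPerm σ → ∀ i → ∃ λ j → lookup σ j ≡ i
lookup-surjective {suc m} σ σ-perm i with Finₚ.any? (λ j → lookup σ j Fin.≟ i)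
... | yes hit = hit
... | no miss = contradiction (Finₚ.injective⇒≤ squeeze-injective) ℕₚ.1+n≰n
  where
  i≢σ : ∀ j → i ≢ lookup σ j
  i≢σ j eq = miss (j , sym eq)
  squeeze-injective : ∀ {j k} → punchOut (i≢σ j) ≡ punchOut (i≢σ k) → j ≡ k
  squeeze-injective {j} {k} eq = lookup-injective σ σ-perm j k (Finₚ.punchOut-injective (i≢σ j) (i≢σ k) eq)

FoundOrAbsent : ∀ {n} → Vecₙ n → Fin n → List (Fin n) → Fin n → Set
FoundOrAbsent σ i js r = lookup σ r ≡ i ⊎ All (λ j → lookup σ j ≢ i) js

-- The search performed by inv is private to Defs, so search-spec leaves the
-- index it returns as a metavariable, solved from the use in inv-spec; the
-- with-abstraction of allFin n makes that solution a pattern.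
mutual
  inv-spec : ∀ {n} (σ : Vecₙ n) i → FoundOrAbsent σ i (allFin n) (lookup (inv σ) i)
  inv-spec {n} σ i with allFin n
  ... | js = subst (FoundOrAbsent σ i js) (sym (Vecₚ.lookup∘tabulate _ i)) (search-spec σ i js)

  search-spec : ∀ {n} (σ : Vecₙ n) i (js : List (Fin n)) → FoundOrAbsent σ i js _
  search-spec σ i [] = inj₂ All.[]
  search-spec σ i (j ∷ js) with lookup σ j Fin.≟ i
  ... | yes σj≡i = inj₁ σj≡i
  ... | no σj≢i with search-spec σ i js
  ...   | inj₁ found = inj₁ found
  ...   | inj₂ absent = inj₂ (σj≢i All.∷ absent)

lookup∘inv : ∀ {n} (σ : Vecₙ n) → IsPerm σ → ∀ i → lookup σ (lookup (inv σ) i) ≡ i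
lookup∘inv σ σ-perm i with inv-spec σ i
... | inj₁ found = found
... | inj₂ absent with j , σj≡i ← lookup-surjective σ σ-perm i =
  contradiction σj≡i (All.lookup absent (∈ₚ.∈-allFin j))

inv∘lookup : ∀ {n} (σ : Vecₙ n) → IsPerm σ → ∀ i → lookup (inv σ) (lookup σ i) ≡ i
inv∘lookup σ σ-perm i = lookup-injective σ σ-perm _ _ (lookup∘inv σ σ-perm (lookup σ i))

invPermutation : ∀ {n} (σ : Vecₙ n) → IsPerm σ → Permutation′ n
invPermutation σ σ-perm = permutation (lookup (inv σ)) (lookup σ) (inv∘lookup σ σ-perm) (lookup∘inv σ σ-perm)

agreements : ∀ {n} → Vecₙ n → Vecₙ n → ℕ
agreements {n} σ θ = ∑[ i ∈ allFin n ] 𝟙[ lookup σ i Fin.≟ lookup θ i ]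

agreements≤n : ∀ {n} (σ θ : Vecₙ n) → agreements σ θ ≤ n
agreements≤n {n} σ θ =
  subst (agreements σ θ ≤_) (∑-allFin-1 n) (∑-mono-≤ (allFin n) (λ i → 𝟙≤1 (lookup σ i Fin.≟ lookup θ i)))

F≤n : ∀ {n} (σ : Vecₙ n) → F σ ≤ n
F≤n {n} σ = subst (F σ ≤_) (Listₚ.length-tabulate {n = n} id) (Listₚ.length-filter _ (allFin n))

-- Reindex the fixed-point count of σ θ⁻¹ by i = θ⁻¹ j.
F-∘inv≡agreements : ∀ {n} (σ θ : Vecₙ n) → IsPerm θ → F (σ ∘ₚ inv θ) ≡ agreements σ θ
F-∘inv≡agreements {n} σ θ θ-perm = begin
  F (σ ∘ₚ inv θ)
    ≡⟨ length-filter≡∑𝟙 (λ j → lookup (σ ∘ₚ inv θ) j Fin.≟ j) (allFin n) ⟩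
  (∑[ j ∈ allFin n ] 𝟙[ lookup (σ ∘ₚ inv θ) j Fin.≟ j ])
    ≡⟨ ∑-cong (allFin n) at-θ⁻¹ ⟩
  (∑[ j ∈ allFin n ] agrees-at (θ⁻¹ ⟨$⟩ʳ j))
    ≡⟨ ∑-allFin-permute θ⁻¹ agrees-at ⟩
  agreements σ θ ∎
  where
  open ≡-Reasoning
  θ⁻¹ : Permutation′ n
  θ⁻¹ = invPermutation θ θ-perm
  agrees-at : Fin n → ℕ
  agrees-at i = 𝟙[ lookup σ i Fin.≟ lookup θ i ]
  at-θ⁻¹ : ∀ j → 𝟙[ lookup (σ ∘ₚ inv θ) j Fin.≟ j ] ≡ agrees-at (θ⁻¹ ⟨$⟩ʳ j)
  at-θ⁻¹ j rewrite Vecₚ.lookup∘tabulate (λ i → lookup σ (lookup (inv θ) i)) j =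
    𝟙-cong (lookup σ (θ⁻¹ ⟨$⟩ʳ j) Fin.≟ j) (lookup σ (θ⁻¹ ⟨$⟩ʳ j) Fin.≟ lookup θ (θ⁻¹ ⟨$⟩ʳ j))
      (λ e → trans e (sym (lookup∘inv θ θ-perm j))) (λ e → trans e (lookup∘inv θ θ-perm j))

dS≡n∸agreements : ∀ {n} (σ θ : Vecₙ n) → IsPerm θ → dS σ θ ≡ n ∸ agreements σ θ
dS≡n∸agreements {n} σ θ θ-perm = cong (n ∸_) (F-∘inv≡agreements σ θ θ-perm)

uniqueᵛ? : ∀ {n k} (τ : Vec (Fin n) k) → Dec (Unique (toList τ))
uniqueᵛ? τ = UniqueDec.unique? Fin._≟_ (toList τ)

arrangements : ℕ → ℕ → ℕ
arrangements n k = ∑[ τ ∈ allVecs n k ] 𝟙[ uniqueᵛ? τ ]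

length-Sym : ∀ n → length (Sym n) ≡ arrangements n n
length-Sym n = length-filter≡∑𝟙 uniqueᵛ? (allVecs n n)

∑-Sym : ∀ n (f : Vecₙ n → ℕ) → ∑ (Sym n) f ≡ (∑[ τ ∈ allVecs n n ] 𝟙[ uniqueᵛ? τ ] * f τ)
∑-Sym n = ∑-filter uniqueᵛ? (allVecs n n)

∑-allVecs-suc : ∀ n k (h : Vec (Fin n) (suc k) → ℕ) →
                ∑ (allVecs n (suc k)) h ≡ (∑[ i ∈ allFin n ] ∑[ τ ∈ allVecs n k ] h (i ∷ τ))
∑-allVecs-suc n k h =
  trans (∑-concatMap (allFin n) _ h) (∑-cong (allFin n) (λ i → ∑-map (allVecs n k) (i ∷_) h))

∑-allVecs-relabel : ∀ {n} (π : Permutation′ n) k (h : Vec (Fin n) k → ℕ) →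
                    (∑[ τ ∈ allVecs n k ] h (Vec.map (π ⟨$⟩ʳ_) τ)) ≡ ∑ (allVecs n k) h
∑-allVecs-relabel π zero h = refl
∑-allVecs-relabel {n} π (suc k) h = begin
  (∑[ τ ∈ allVecs n (suc k) ] h (Vec.map (π ⟨$⟩ʳ_) τ))
    ≡⟨ ∑-allVecs-suc n k _ ⟩
  (∑[ i ∈ allFin n ] ∑[ τ ∈ allVecs n k ] h ((π ⟨$⟩ʳ i) ∷ Vec.map (π ⟨$⟩ʳ_) τ))
    ≡⟨ ∑-cong (allFin n) (λ i → ∑-allVecs-relabel π k (λ τ → h ((π ⟨$⟩ʳ i) ∷ τ))) ⟩
  (∑[ i ∈ allFin n ] ∑[ τ ∈ allVecs n k ] h ((π ⟨$⟩ʳ i) ∷ τ))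
    ≡⟨ ∑-allFin-permute π (λ i → ∑[ τ ∈ allVecs n k ] h (i ∷ τ)) ⟩
  (∑[ i ∈ allFin n ] ∑[ τ ∈ allVecs n k ] h (i ∷ τ))
    ≡⟨ ∑-allVecs-suc n k h ⟨
  ∑ (allVecs n (suc k)) h ∎
  where open ≡-Reasoning

𝟙-unique-map : ∀ {n k} (π : Permutation′ n) (τ : Vec (Fin n) k) →
               𝟙[ uniqueᵛ? (Vec.map (π ⟨$⟩ʳ_) τ) ] ≡ 𝟙[ uniqueᵛ? τ ]
𝟙-unique-map π τ = 𝟙-cong (uniqueᵛ? (Vec.map (π ⟨$⟩ʳ_) τ)) (uniqueᵛ? τ)
  (λ πτ! → Uniqueₚ.map⁻ (subst Unique (Vecₚ.toList-map (π ⟨$⟩ʳ_) τ) πτ!))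
  (λ τ! → subst Unique (sym (Vecₚ.toList-map (π ⟨$⟩ʳ_) τ)) (Uniqueₚ.map⁺ π-injective τ!))
  where
  π-injective : ∀ {x y} → π ⟨$⟩ʳ x ≡ π ⟨$⟩ʳ y → x ≡ y
  π-injective {x} {y} eq = trans (sym (inverseˡ π)) (trans (cong (π ⟨$⟩ˡ_) eq) (inverseˡ π))

#sending : ∀ n → Fin n → Fin n → ℕ
#sending n i a = ∑[ τ ∈ allVecs n n ] 𝟙[ uniqueᵛ? τ ] * 𝟙[ lookup τ i Fin.≟ a ]

#sending-relabel : ∀ {n} (π : Permutation′ n) i a → #sending n i (π ⟨$⟩ˡ a) ≡ #sending n i a
#sending-relabel {n} π i a = begin
  #sending n i (π ⟨$⟩ˡ a)
    ≡⟨ ∑-cong (allVecs n n) relabelled ⟩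
  (∑[ τ ∈ allVecs n n ] sends-to-a (Vec.map (π ⟨$⟩ʳ_) τ))
    ≡⟨ ∑-allVecs-relabel π n sends-to-a ⟩
  #sending n i a ∎
  where
  open ≡-Reasoning
  sends-to-a : Vecₙ n → ℕ
  sends-to-a τ = 𝟙[ uniqueᵛ? τ ] * 𝟙[ lookup τ i Fin.≟ a ]
  relabelled : ∀ τ → 𝟙[ uniqueᵛ? τ ] * 𝟙[ lookup τ i Fin.≟ π ⟨$⟩ˡ a ] ≡ sends-to-a (Vec.map (π ⟨$⟩ʳ_) τ)
  relabelled τ rewrite 𝟙-unique-map π τ | Vecₚ.lookup-map i (π ⟨$⟩ʳ_) τ =
    cong (𝟙[ uniqueᵛ? τ ] *_) (𝟙-cong (lookup τ i Fin.≟ π ⟨$⟩ˡ a) (π ⟨$⟩ʳ lookup τ i Fin.≟ a)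
      (λ e → trans (cong (π ⟨$⟩ʳ_) e) (inverseʳ π))
      (λ e → trans (sym (inverseˡ π)) (cong (π ⟨$⟩ˡ_) e)))

transpose-⟨$⟩ˡ : ∀ {n} (a b : Fin n) → transpose b a ⟨$⟩ˡ a ≡ b
transpose-⟨$⟩ˡ a b with a Fin.≟ a
... | yes _ = refl
... | no a≢a = contradiction refl a≢a

#sending-constant : ∀ n i (a b : Fin n) → #sending n i a ≡ #sending n i b
#sending-constant n i a b =
  trans (cong (#sending n i) (sym (transpose-⟨$⟩ˡ b a))) (#sending-relabel (transpose a b) i b)

∑-#sending : ∀ n i → ∑ (allFin n) (#sending n i) ≡ arrangements n n
∑-#sending n i = begin
  ∑ (allFin n) (#sending n i)
    ≡⟨ ∑-comm (allFin n) (allVecs n n) _ ⟩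
  (∑[ τ ∈ allVecs n n ] ∑[ a ∈ allFin n ] 𝟙[ uniqueᵛ? τ ] * 𝟙[ lookup τ i Fin.≟ a ])
    ≡⟨ ∑-cong (allVecs n n) counted-once ⟩
  arrangements n n ∎
  where
  open ≡-Reasoning
  counted-once : ∀ τ → (∑[ a ∈ allFin n ] 𝟙[ uniqueᵛ? τ ] * 𝟙[ lookup τ i Fin.≟ a ]) ≡ 𝟙[ uniqueᵛ? τ ]
  counted-once τ = trans (∑-*ˡ (allFin n) 𝟙[ uniqueᵛ? τ ] _)
    (trans (cong (𝟙[ uniqueᵛ? τ ] *_) (∑-allFin-𝟙-≟ˡ (lookup τ i))) (ℕₚ.*-identityʳ _))

n*#sending≡arrangements : ∀ n i (a : Fin n) → n * #sending n i a ≡ arrangements n n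
n*#sending≡arrangements n i a = begin
  n * #sending n i a                ≡⟨ ∑-allFin-const n (#sending n i a) ⟨
  (∑[ _ ∈ allFin n ] #sending n i a) ≡⟨ ∑-cong (allFin n) (#sending-constant n i a) ⟩
  ∑ (allFin n) (#sending n i)       ≡⟨ ∑-#sending n i ⟩
  arrangements n n                  ∎
  where open ≡-Reasoning

∑-Sym-F≡∑-#sending : ∀ n → ∑ (Sym n) F ≡ (∑[ i ∈ allFin n ] #sending n i i)
∑-Sym-F≡∑-#sending n = begin
  ∑ (Sym n) F
    ≡⟨ ∑-Sym n F ⟩
  (∑[ τ ∈ allVecs n n ] 𝟙[ uniqueᵛ? τ ] * F τ)
    ≡⟨ ∑-cong (allVecs n n) count-fixed ⟩
  (∑[ τ ∈ allVecs n n ] ∑[ i ∈ allFin n ] 𝟙[ uniqueᵛ? τ ] * 𝟙[ lookup τ i Fin.≟ i ])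
    ≡⟨ ∑-comm (allVecs n n) (allFin n) _ ⟩
  (∑[ i ∈ allFin n ] #sending n i i) ∎
  where
  open ≡-Reasoning
  count-fixed : ∀ τ → 𝟙[ uniqueᵛ? τ ] * F τ ≡ (∑[ i ∈ allFin n ] 𝟙[ uniqueᵛ? τ ] * 𝟙[ lookup τ i Fin.≟ i ])
  count-fixed τ = trans (cong (𝟙[ uniqueᵛ? τ ] *_) (length-filter≡∑𝟙 (λ i → lookup τ i Fin.≟ i) (allFin n)))
                        (sym (∑-*ˡ (allFin n) 𝟙[ uniqueᵛ? τ ] _))

-- Position i is fixed by exactly a 1/n share of S_n, as #sending n i a does not depend on a.
∑-Sym-F≡length-Sym : ∀ n .{{_ : NonZero n}} → ∑ (Sym n) F ≡ length (Sym n)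
∑-Sym-F≡length-Sym n = ℕₚ.*-cancelˡ-≡ _ _ n (begin
  n * ∑ (Sym n) F
    ≡⟨ cong (n *_) (∑-Sym-F≡∑-#sending n) ⟩
  n * (∑[ i ∈ allFin n ] #sending n i i)
    ≡⟨ ∑-*ˡ (allFin n) n _ ⟨
  (∑[ i ∈ allFin n ] n * #sending n i i)
    ≡⟨ ∑-cong (allFin n) (λ i → n*#sending≡arrangements n i i) ⟩
  (∑[ _ ∈ allFin n ] arrangements n n)
    ≡⟨ ∑-allFin-const n (arrangements n n) ⟩
  n * arrangements n n
    ≡⟨ cong (n *_) (length-Sym n) ⟨
  n * length (Sym n) ∎)
  where open ≡-Reasoning

occurrences : ∀ {n} → Fin n → List (Fin n) → ℕ
occurrences i xs = ∑[ x ∈ xs ] 𝟙[ i Fin.≟ x ]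

occurrences≡0⇒∉ : ∀ {n} (i : Fin n) xs → occurrences i xs ≡ 0 → All (i ≢_) xs
occurrences≡0⇒∉ i [] _ = All.[]
occurrences≡0⇒∉ i (x ∷ xs) eq with i Fin.≟ x
... | yes _ = contradiction eq λ ()
... | no i≢x = i≢x All.∷ occurrences≡0⇒∉ i xs eq

∉⇒occurrences≡0 : ∀ {n} (i : Fin n) xs → All (i ≢_) xs → occurrences i xs ≡ 0
∉⇒occurrences≡0 i [] _ = refl
∉⇒occurrences≡0 i (x ∷ xs) (i≢x All.∷ i∉xs) = cong₂ _+_ (𝟙-no (i Fin.≟ x) i≢x) (∉⇒occurrences≡0 i xs i∉xs)

occurrences≤1 : ∀ {n} (i : Fin n) {xs} → Unique xs → occurrences i xs ≤ 1
occurrences≤1 i [] = z≤n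
occurrences≤1 i {x ∷ xs} (x∉xs ∷ xs!) with i Fin.≟ x
... | yes refl = subst (λ o → 1 + o ≤ 1) (sym (∉⇒occurrences≡0 i xs x∉xs)) ℕₚ.≤-refl
... | no _ = occurrences≤1 i xs!

𝟙-unique-∷ : ∀ {n k} (i : Fin n) (τ : Vec (Fin n) k) →
             𝟙[ uniqueᵛ? (i ∷ τ) ] ≡ 𝟙[ occurrences i (toList τ) ℕ.≟ 0 ] * 𝟙[ uniqueᵛ? τ ]
𝟙-unique-∷ i τ = trans
  (𝟙-cong (uniqueᵛ? (i ∷ τ)) (occurrences i (toList τ) ℕ.≟ 0 ×-dec uniqueᵛ? τ)
    (λ { (i∉τ ∷ τ!) → ∉⇒occurrences≡0 i _ i∉τ , τ! })
    (λ { (absent , τ!) → occurrences≡0⇒∉ i _ absent ∷ τ! }))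
  (𝟙-×-dec (occurrences i (toList τ) ℕ.≟ 0) (uniqueᵛ? τ))

#unused : ∀ {n k} (τ : Vec (Fin n) k) → Unique (toList τ) →
          (∑[ i ∈ allFin n ] 𝟙[ occurrences i (toList τ) ℕ.≟ 0 ]) ≡ n ∸ k
#unused {n} {k} τ τ! = begin
  ∑ (allFin n) unused
    ≡⟨ ℕₚ.m+n∸n≡m _ k ⟨
  ∑ (allFin n) unused + k ∸ k
    ≡⟨ cong (λ o → ∑ (allFin n) unused + o ∸ k) ∑-occurrences ⟨
  ∑ (allFin n) unused + ∑ (allFin n) occurs ∸ k
    ≡⟨ cong (_∸ k) (∑-distrib-+ (allFin n) unused occurs) ⟨
  (∑[ i ∈ allFin n ] unused i + occurs i) ∸ k
    ≡⟨ cong (_∸ k) (trans (∑-cong (allFin n) unused+occurs) (∑-allFin-1 n)) ⟩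
  n ∸ k ∎
  where
  open ≡-Reasoning
  occurs unused : Fin n → ℕ
  occurs i = occurrences i (toList τ)
  unused i = 𝟙[ occurs i ℕ.≟ 0 ]
  ∑-occurrences : ∑ (allFin n) occurs ≡ k
  ∑-occurrences = begin
    ∑ (allFin n) occurs
      ≡⟨ ∑-comm (allFin n) (toList τ) _ ⟩
    (∑[ x ∈ toList τ ] ∑[ i ∈ allFin n ] 𝟙[ i Fin.≟ x ])
      ≡⟨ ∑-cong (toList τ) ∑-allFin-𝟙-≟ʳ ⟩
    (∑[ _ ∈ toList τ ] 1)
      ≡⟨ ∑-1 (toList τ) ⟩
    length (toList τ)
      ≡⟨ Vecₚ.length-toList τ ⟩
    k ∎
  unused+occurs : ∀ i → unused i + occurs i ≡ 1
  unused+occurs i with occurs i | occurrences≤1 i τ!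
  ... | zero | _ = refl
  ... | suc zero | _ = refl
  ... | suc (suc _) | s≤s ()

arrangements-suc : ∀ n k → arrangements n (suc k) ≡ (n ∸ k) * arrangements n k
arrangements-suc n k = begin
  arrangements n (suc k)
    ≡⟨ ∑-allVecs-suc n k _ ⟩
  (∑[ i ∈ allFin n ] ∑[ τ ∈ allVecs n k ] 𝟙[ uniqueᵛ? (i ∷ τ) ])
    ≡⟨ ∑-cong (allFin n) (λ i → ∑-cong (allVecs n k) (𝟙-unique-∷ i)) ⟩
  (∑[ i ∈ allFin n ] ∑[ τ ∈ allVecs n k ] 𝟙[ occurrences i (toList τ) ℕ.≟ 0 ] * 𝟙[ uniqueᵛ? τ ])
    ≡⟨ ∑-comm (allFin n) (allVecs n k) _ ⟩
  (∑[ τ ∈ allVecs n k ] ∑[ i ∈ allFin n ] 𝟙[ occurrences i (toList τ) ℕ.≟ 0 ] * 𝟙[ uniqueᵛ? τ ])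
    ≡⟨ ∑-cong (allVecs n k) extensions ⟩
  (∑[ τ ∈ allVecs n k ] (n ∸ k) * 𝟙[ uniqueᵛ? τ ])
    ≡⟨ ∑-*ˡ (allVecs n k) (n ∸ k) _ ⟩
  (n ∸ k) * arrangements n k ∎
  where
  open ≡-Reasoning
  extensions : ∀ τ → (∑[ i ∈ allFin n ] 𝟙[ occurrences i (toList τ) ℕ.≟ 0 ] * 𝟙[ uniqueᵛ? τ ])
                     ≡ (n ∸ k) * 𝟙[ uniqueᵛ? τ ]
  extensions τ = trans (∑-*ʳ (allFin n) 𝟙[ uniqueᵛ? τ ] _) (*-𝟙-cong (uniqueᵛ? τ) (#unused τ))

arrangements*! : ∀ n k → k ≤ n → arrangements n k * (n ∸ k) ! ≡ n !
arrangements*! n zero _ = ℕₚ.+-identityʳ (n !)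
arrangements*! n (suc k) k<n = begin
  arrangements n (suc k) * (n ∸ suc k) !
    ≡⟨ cong (_* (n ∸ suc k) !) (arrangements-suc n k) ⟩
  (n ∸ k) * arrangements n k * (n ∸ suc k) !
    ≡⟨ cong (λ m → m * arrangements n k * (n ∸ suc k) !) n∸k≡1+n∸1+k ⟩
  suc (n ∸ suc k) * arrangements n k * (n ∸ suc k) !
    ≡⟨ reassociate (n ∸ suc k) (arrangements n k) ((n ∸ suc k) !) ⟩
  arrangements n k * (suc (n ∸ suc k) * (n ∸ suc k) !)
    ≡⟨ cong (λ m → arrangements n k * m !) n∸k≡1+n∸1+k ⟨
  arrangements n k * (n ∸ k) !
    ≡⟨ arrangements*! n k (ℕₚ.<⇒≤ k<n) ⟩
  n ! ∎
  where
  open ≡-Reasoning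
  n∸k≡1+n∸1+k : n ∸ k ≡ suc (n ∸ suc k)
  n∸k≡1+n∸1+k = ℕₚ.+-∸-assoc 1 k<n
  reassociate : ∀ a b c → suc a * b * c ≡ b * (suc a * c)
  reassociate = solve-∀

length-Sym≡n! : ∀ n → length (Sym n) ≡ n !
length-Sym≡n! n = begin
  length (Sym n)                  ≡⟨ length-Sym n ⟩
  arrangements n n                ≡⟨ ℕₚ.*-identityʳ _ ⟨
  arrangements n n * 0 !          ≡⟨ cong (λ m → arrangements n n * m !) (ℕₚ.n∸n≡0 n) ⟨
  arrangements n n * (n ∸ n) !    ≡⟨ arrangements*! n n ℕₚ.≤-refl ⟩
  n !                             ∎
  where open ≡-Reasoning

frac-toℚᵘ : ∀ a d → toℚᵘ (frac a (suc d)) ≃ᵘ mkℚᵘ (ℤ.+ a) d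
frac-toℚᵘ a d = ℚₚ.toℚᵘ-fromℚᵘ (mkℚᵘ (ℤ.+ a) d)

mkℚᵘ-*-integer : ∀ a b d → mkℚᵘ (ℤ.+ a) d ℚᵘ.* mkℚᵘ (ℤ.+ b) 0 ≃ᵘ mkℚᵘ (ℤ.+ (a * b)) d
mkℚᵘ-*-integer a b d = *≡* (begin
  ℤ.+ a ℤ.* ℤ.+ b ℤ.* ℤ.+ suc d    ≡⟨ cong (ℤ._* ℤ.+ suc d) (ℤₚ.pos-* a b) ⟨
  ℤ.+ (a * b) ℤ.* ℤ.+ suc d         ≡⟨ cong (λ m → ℤ.+ (a * b) ℤ.* ℤ.+ suc m) (ℕₚ.*-identityʳ d) ⟨
  ℤ.+ (a * b) ℤ.* ℤ.+ suc (d * 1)   ∎)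
  where open ≡-Reasoning

mkℚᵘ-+-same-denominator : ∀ a b d → mkℚᵘ (ℤ.+ a) d ℚᵘ.+ mkℚᵘ (ℤ.+ b) d ≃ᵘ mkℚᵘ (ℤ.+ (a + b)) d
mkℚᵘ-+-same-denominator a b d = *≡* (begin
  (ℤ.+ a ℤ.* ℤ.+ suc d ℤ.+ ℤ.+ b ℤ.* ℤ.+ suc d) ℤ.* ℤ.+ suc d
    ≡⟨ cong (ℤ._* ℤ.+ suc d) (ℤₚ.*-distribʳ-+ (ℤ.+ suc d) (ℤ.+ a) (ℤ.+ b)) ⟨
  (ℤ.+ a ℤ.+ ℤ.+ b) ℤ.* ℤ.+ suc d ℤ.* ℤ.+ suc d
    ≡⟨ ℤₚ.*-assoc (ℤ.+ (a + b)) (ℤ.+ suc d) (ℤ.+ suc d) ⟩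
  ℤ.+ (a + b) ℤ.* (ℤ.+ suc d ℤ.* ℤ.+ suc d) ∎)
  where open ≡-Reasoning

sumℚ-frac : ∀ d (c e : ℕ → ℕ) (js : List ℕ) →
            toℚᵘ (sumℚ (map (λ j → frac (c j) (suc d) ℚ.* frac (e j) 1) js))
              ≃ᵘ mkℚᵘ (ℤ.+ (∑[ j ∈ js ] c j * e j)) d
sumℚ-frac d c e [] = *≡* refl
sumℚ-frac d c e (j ∷ js) =
  ℚᵘₚ.≃-trans (ℚₚ.toℚᵘ-homo-+ (frac (c j) (suc d) ℚ.* frac (e j) 1) _)
  (ℚᵘₚ.≃-trans (ℚᵘₚ.+-cong term (sumℚ-frac d c e js))
  (mkℚᵘ-+-same-denominator (c j * e j) _ d))
  where
  term = ℚᵘₚ.≃-trans (ℚₚ.toℚᵘ-homo-* (frac (c j) (suc d)) (frac (e j) 1))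
           (ℚᵘₚ.≃-trans (ℚᵘₚ.*-cong (frac-toℚᵘ (c j) d) (frac-toℚᵘ (e j) 0)) (mkℚᵘ-*-integer (c j) (e j) d))

sumℚ-frac-cross-multiply : ∀ d d′ .{{_ : NonZero d}} .{{_ : NonZero d′}} (c c′ e : ℕ → ℕ) (js : List ℕ) →
  sumℚ (map (λ j → frac (c j) d ℚ.* frac (e j) 1) js) ≡ sumℚ (map (λ j → frac (c′ j) d′ ℚ.* frac (e j) 1) js) →
  (∑[ j ∈ js ] c j * e j) * d′ ≡ (∑[ j ∈ js ] c′ j * e j) * d
sumℚ-frac-cross-multiply (suc d) (suc d′) c c′ e js eq
  with *≡* cross ← ℚᵘₚ.≃-trans (ℚᵘₚ.≃-sym (sumℚ-frac d c e js))
                                (ℚᵘₚ.≃-trans (ℚₚ.toℚᵘ-cong eq) (sumℚ-frac d′ c′ e js)) =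
  ℤₚ.+-injective (trans (ℤₚ.pos-* (∑[ j ∈ js ] c j * e j) (suc d′))
                 (trans cross (sym (ℤₚ.pos-* (∑[ j ∈ js ] c′ j * e j) (suc d)))))

∑-by-level-sets : ∀ {a} {A : Set a} (xs : List A) (g : A → ℕ) n → (∀ x → g x ≤ n) →
                  (∑[ j ∈ upTo (suc n) ] length (filter (λ x → g x ℕ.≟ j) xs) * j) ≡ ∑ xs g
∑-by-level-sets xs g n g≤n = begin
  (∑[ j ∈ upTo (suc n) ] length (filter (λ x → g x ℕ.≟ j) xs) * j)
    ≡⟨ ∑-cong (upTo (suc n)) level-set ⟩
  (∑[ j ∈ upTo (suc n) ] ∑[ x ∈ xs ] 𝟙[ g x ℕ.≟ j ] * j)
    ≡⟨ ∑-comm (upTo (suc n)) xs _ ⟩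
  (∑[ x ∈ xs ] ∑[ j ∈ upTo (suc n) ] 𝟙[ g x ℕ.≟ j ] * j)
    ≡⟨ ∑-cong xs (λ x → ∑-𝟙-≟-pick ℕ._≟_ (Uniqueₚ.upTo⁺ (suc n)) (∈ₚ.∈-upTo⁺ (s≤s (g≤n x))) id) ⟩
  ∑ xs g ∎
  where
  open ≡-Reasoning
  level-set : ∀ j → length (filter (λ x → g x ℕ.≟ j) xs) * j ≡ (∑[ x ∈ xs ] 𝟙[ g x ℕ.≟ j ] * j)
  level-set j = trans (cong (_* j) (length-filter≡∑𝟙 (λ x → g x ℕ.≟ j) xs)) (sym (∑-*ʳ xs j _))

v≡#atDistance : ∀ n j → j ≤ n → v n j ≡ length (filter (λ σ → (n ∸ F σ) ℕ.≟ j) (Sym n))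
v≡#atDistance n j j≤n = cong length (Listₚ.filter-≐ (λ σ → F σ ℕ.≟ n ∸ j) (λ σ → (n ∸ F σ) ℕ.≟ j)
  ((λ {σ} F≡n∸j → trans (cong (n ∸_) F≡n∸j) (ℕₚ.m∸[m∸n]≡n j≤n)) ,
   (λ {σ} n∸F≡j → trans (sym (ℕₚ.m∸[m∸n]≡n (F≤n σ))) (cong (n ∸_) n∸F≡j)))
  (Sym n))

totalAgreement : ∀ {n} → List (Vecₙ n) → ℕ
totalAgreement D = ∑[ σ ∈ D ] ∑[ θ ∈ D ] agreements σ θ

-- The i = 1 moment condition, cleared of denominators: the mean distance within D equals the mean distance in S_n.
1-design⇒mean-distance : ∀ n (D : List (Vecₙ n)) .{{_ : NonZero (length D)}} → All IsPerm D → IsDesign 1 D →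
  (∑[ σ ∈ D ] ∑[ θ ∈ D ] n ∸ agreements σ θ) * n ! ≡ (∑[ σ ∈ Sym n ] n ∸ F σ) * (length D * length D)
1-design⇒mean-distance n D D-perm design = begin
  (∑[ σ ∈ D ] ∑[ θ ∈ D ] n ∸ agreements σ θ) * n !
    ≡⟨ cong (_* n !) within-D ⟨
  (∑[ j ∈ upTo (suc n) ] #pairsAt j * j ^ 1) * n !
    ≡⟨ sumℚ-frac-cross-multiply (length D * length D) (n !) #pairsAt (v n) (_^ 1) (upTo (suc n))
                                (design 1 ℕₚ.≤-refl ℕₚ.≤-refl) ⟩
  (∑[ j ∈ upTo (suc n) ] v n j * j ^ 1) * (length D * length D)
    ≡⟨ cong (_* (length D * length D)) in-Sym ⟩
  (∑[ σ ∈ Sym n ] n ∸ F σ) * (length D * length D) ∎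
  where
  open ≡-Reasoning
  instance
    n!≢0 : NonZero (n !)
    n!≢0 = n ℕₚ.!≢0
    k²≢0 : NonZero (length D * length D)
    k²≢0 = ℕₚ.m*n≢0 (length D) (length D)
  dist : Vecₙ n × Vecₙ n → ℕ
  dist (σ , θ) = dS σ θ
  #pairsAt : ℕ → ℕ
  #pairsAt j = length (filter (λ p → dist p ℕ.≟ j) (cartesianProduct D D))
  within-D : (∑[ j ∈ upTo (suc n) ] #pairsAt j * j ^ 1) ≡ (∑[ σ ∈ D ] ∑[ θ ∈ D ] n ∸ agreements σ θ)
  within-D = begin
    (∑[ j ∈ upTo (suc n) ] #pairsAt j * j ^ 1)
      ≡⟨ ∑-cong (upTo (suc n)) (λ j → cong (#pairsAt j *_) (ℕₚ.*-identityʳ j)) ⟩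
    (∑[ j ∈ upTo (suc n) ] #pairsAt j * j)
      ≡⟨ ∑-by-level-sets (cartesianProduct D D) dist n (λ (σ , θ) → ℕₚ.m∸n≤m n (F (σ ∘ₚ inv θ))) ⟩
    ∑ (cartesianProduct D D) dist
      ≡⟨ ∑-cartesianProduct D D dist ⟩
    (∑[ σ ∈ D ] ∑[ θ ∈ D ] dS σ θ)
      ≡⟨ ∑-cong D (λ σ → ∑-cong-∈ D (λ θ∈D → dS≡n∸agreements σ _ (All.lookup D-perm θ∈D))) ⟩
    (∑[ σ ∈ D ] ∑[ θ ∈ D ] n ∸ agreements σ θ) ∎
  in-Sym : (∑[ j ∈ upTo (suc n) ] v n j * j ^ 1) ≡ (∑[ σ ∈ Sym n ] n ∸ F σ)
  in-Sym = begin
    (∑[ j ∈ upTo (suc n) ] v n j * j ^ 1)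
      ≡⟨ ∑-cong-∈ (upTo (suc n)) (λ j∈ → cong₂ _*_ (v≡#atDistance n _ (ℕₚ.≤-pred (∈ₚ.∈-upTo⁻ j∈)))
                                                    (ℕₚ.*-identityʳ _)) ⟩
    (∑[ j ∈ upTo (suc n) ] length (filter (λ σ → (n ∸ F σ) ℕ.≟ j) (Sym n)) * j)
      ≡⟨ ∑-by-level-sets (Sym n) (λ σ → n ∸ F σ) n (λ σ → ℕₚ.m∸n≤m n (F σ)) ⟩
    (∑[ σ ∈ Sym n ] n ∸ F σ) ∎

1-design⇒totalAgreement≡length² : ∀ n .{{_ : NonZero n}} (D : List (Vecₙ n)) .{{_ : NonZero (length D)}} →
  All IsPerm D → IsDesign 1 D → totalAgreement D ≡ (length D) ²
1-design⇒totalAgreement≡length² n D D-perm design =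
  cancel {{n ℕₚ.!≢0}} (1-design⇒mean-distance n D D-perm design) within-D in-Sym
  where
  k = length D
  within-D : (∑[ σ ∈ D ] ∑[ θ ∈ D ] n ∸ agreements σ θ) + totalAgreement D ≡ k * (k * n)
  within-D = begin
    (∑[ σ ∈ D ] ∑[ θ ∈ D ] n ∸ agreements σ θ) + totalAgreement D
      ≡⟨ ∑-distrib-+ D _ _ ⟨
    (∑[ σ ∈ D ] (∑[ θ ∈ D ] n ∸ agreements σ θ) + ∑ D (agreements σ))
      ≡⟨ ∑-cong D (λ σ → ∑-∸-complement D n (agreements σ) (agreements≤n σ)) ⟩
    (∑[ _ ∈ D ] k * n)
      ≡⟨ ∑-const D (k * n) ⟩
    k * (k * n) ∎
    where open ≡-Reasoning
  in-Sym : (∑[ σ ∈ Sym n ] n ∸ F σ) + n ! ≡ n ! * n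
  in-Sym = begin
    (∑[ σ ∈ Sym n ] n ∸ F σ) + n !
      ≡⟨ cong ((∑[ σ ∈ Sym n ] n ∸ F σ) +_) (trans (∑-Sym-F≡length-Sym n) (length-Sym≡n! n)) ⟨
    (∑[ σ ∈ Sym n ] n ∸ F σ) + ∑ (Sym n) F
      ≡⟨ ∑-∸-complement (Sym n) n F F≤n ⟩
    length (Sym n) * n
      ≡⟨ cong (_* n) (length-Sym≡n! n) ⟩
    n ! * n ∎
    where open ≡-Reasoning
  cancel : ∀ {X Y T f} .{{_ : NonZero f}} → X * f ≡ Y * (k * k) → X + T ≡ k * (k * n) → Y + f ≡ f * n → T ≡ k * k
  cancel {X} {Y} {T} {f} Xf≡YK X+T≡Kn Y+f≡fn = ℕₚ.*-cancelʳ-≡ T (k * k) f (ℕₚ.+-cancelˡ-≡ (X * f) _ _ (begin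
    X * f + T * f         ≡⟨ ℕₚ.*-distribʳ-+ f X T ⟨
    (X + T) * f           ≡⟨ cong (_* f) X+T≡Kn ⟩
    k * (k * n) * f       ≡⟨ reorder k n f ⟩
    f * n * (k * k)       ≡⟨ cong (_* (k * k)) Y+f≡fn ⟨
    (Y + f) * (k * k)     ≡⟨ ℕₚ.*-distribʳ-+ (k * k) Y f ⟩
    Y * (k * k) + f * (k * k) ≡⟨ cong₂ _+_ Xf≡YK (ℕₚ.*-comm (k * k) f) ⟨
    X * f + k * k * f     ∎))
    where
    open ≡-Reasoning
    reorder : ∀ k n f → k * (k * n) * f ≡ f * n * (k * k)
    reorder = solve-∀

#at : ∀ {n} → List (Vecₙ n) → Fin n → Fin n → ℕ
#at D i a = ∑[ θ ∈ D ] 𝟙[ lookup θ i Fin.≟ a ]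

collisionsAt : ∀ {n} → List (Vecₙ n) → Fin n → ℕ
collisionsAt {n} D i = ∑[ a ∈ allFin n ] #at D i a ²

totalAgreement≡∑-collisionsAt : ∀ {n} (D : List (Vecₙ n)) → totalAgreement D ≡ ∑ (allFin n) (collisionsAt D)
totalAgreement≡∑-collisionsAt {n} D = begin
  (∑[ σ ∈ D ] ∑[ θ ∈ D ] ∑[ i ∈ allFin n ] 𝟙[ lookup σ i Fin.≟ lookup θ i ])
    ≡⟨ ∑-cong D (λ σ → ∑-comm D (allFin n) _) ⟩
  (∑[ σ ∈ D ] ∑[ i ∈ allFin n ] ∑[ θ ∈ D ] 𝟙[ lookup σ i Fin.≟ lookup θ i ])
    ≡⟨ ∑-comm D (allFin n) _ ⟩
  (∑[ i ∈ allFin n ] ∑[ σ ∈ D ] ∑[ θ ∈ D ] 𝟙[ lookup σ i Fin.≟ lookup θ i ])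
    ≡⟨ ∑-cong (allFin n) (λ i → ∑-cong D (λ σ → ∑-cong D (λ θ → 𝟙-≟-sym Fin._≟_ _ _))) ⟩
  (∑[ i ∈ allFin n ] ∑[ σ ∈ D ] #at D i (lookup σ i))
    ≡⟨ ∑-cong (allFin n) (λ i → ∑-cong D (λ σ → ∑-allFin-pick (lookup σ i) (#at D i))) ⟨
  (∑[ i ∈ allFin n ] ∑[ σ ∈ D ] ∑[ a ∈ allFin n ] 𝟙[ lookup σ i Fin.≟ a ] * #at D i a)
    ≡⟨ ∑-cong (allFin n) (λ i → ∑-comm D (allFin n) _) ⟩
  (∑[ i ∈ allFin n ] ∑[ a ∈ allFin n ] ∑[ σ ∈ D ] 𝟙[ lookup σ i Fin.≟ a ] * #at D i a)
    ≡⟨ ∑-cong (allFin n) (λ i → ∑-cong (allFin n) (λ a → ∑-*ʳ D (#at D i a) _)) ⟩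
  ∑ (allFin n) (collisionsAt D) ∎
  where open ≡-Reasoning

∑-#at : ∀ {n} (D : List (Vecₙ n)) i → ∑ (allFin n) (#at D i) ≡ length D
∑-#at {n} D i = begin
  (∑[ a ∈ allFin n ] ∑[ θ ∈ D ] 𝟙[ lookup θ i Fin.≟ a ])
    ≡⟨ ∑-comm (allFin n) D _ ⟩
  (∑[ θ ∈ D ] ∑[ a ∈ allFin n ] 𝟙[ lookup θ i Fin.≟ a ])
    ≡⟨ ∑-cong D (λ θ → ∑-allFin-𝟙-≟ˡ (lookup θ i)) ⟩
  (∑[ _ ∈ D ] 1)
    ≡⟨ ∑-1 D ⟩
  length D ∎
  where open ≡-Reasoning

n≤n² : ∀ n → n ≤ n ²
n≤n² zero = z≤n
n≤n² (suc n) = ℕₚ.m≤m*n (suc n) (suc n)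

length²≤n*collisionsAt : ∀ {n} (D : List (Vecₙ n)) i → (length D) ² ≤ n * collisionsAt D i
length²≤n*collisionsAt {n} D i =
  subst₂ _≤_ (cong _² (trans (∑-cong (allFin n) (λ a → ℕₚ.*-identityˡ (#at D i a))) (∑-#at D i)))
             (cong (_* collisionsAt D i) (∑-allFin-1 n))
             (cauchy-schwarz (allFin n) (λ _ → 1) (#at D i))

-- Cauchy–Schwarz over the n - 1 values other than the missing one a₀, plus length D ≤ collisionsAt D i.
missing-value⇒length²<n*collisionsAt : ∀ {m} (D : List (Vecₙ (suc m))) .{{_ : NonZero (length D)}} i a₀ →
  #at D i a₀ ≡ 0 → 1 + (length D) ² ≤ suc m * collisionsAt D i
missing-value⇒length²<n*collisionsAt {m} D i a₀ a₀-missing = begin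
  1 + k ²                  ≤⟨ ℕₚ.+-monoˡ-≤ (k ²) (ℕₚ.≤-trans (ℕ.>-nonZero⁻¹ k) k≤collisions) ⟩
  collisionsAt D i + k ²   ≤⟨ ℕₚ.+-monoʳ-≤ (collisionsAt D i) k²≤m*collisions ⟩
  suc m * collisionsAt D i ∎
  where
  open ℕₚ.≤-Reasoning
  n = suc m
  k = length D
  k≤collisions : k ≤ collisionsAt D i
  k≤collisions = subst (_≤ collisionsAt D i) (∑-#at D i) (∑-mono-≤ (allFin n) (λ a → n≤n² (#at D i a)))
  other : Fin n → ℕ
  other a = 1 ∸ 𝟙[ a Fin.≟ a₀ ]
  other*#at : ∀ a → other a * #at D i a ≡ #at D i a
  other*#at a with a Fin.≟ a₀
  ... | yes refl = sym a₀-missing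
  ... | no _ = ℕₚ.*-identityˡ _
  other²+𝟙 : ∀ a → other a ² + 𝟙[ a Fin.≟ a₀ ] ≡ 1
  other²+𝟙 a with a Fin.≟ a₀
  ... | yes _ = refl
  ... | no _ = refl
  ∑-other² : (∑[ a ∈ allFin n ] other a ²) ≡ m
  ∑-other² = ℕₚ.+-cancelʳ-≡ 1 _ _ (begin-equality
    (∑[ a ∈ allFin n ] other a ²) + 1
      ≡⟨ cong ((∑[ a ∈ allFin n ] other a ²) +_) (∑-allFin-𝟙-≟ʳ a₀) ⟨
    (∑[ a ∈ allFin n ] other a ²) + (∑[ a ∈ allFin n ] 𝟙[ a Fin.≟ a₀ ])
      ≡⟨ ∑-distrib-+ (allFin n) (λ a → other a ²) (λ a → 𝟙[ a Fin.≟ a₀ ]) ⟨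
    (∑[ a ∈ allFin n ] other a ² + 𝟙[ a Fin.≟ a₀ ])
      ≡⟨ trans (∑-cong (allFin n) other²+𝟙) (∑-allFin-1 n) ⟩
    suc m
      ≡⟨ ℕₚ.+-comm 1 m ⟩
    m + 1 ∎)
  k²≤m*collisions : k ² ≤ m * collisionsAt D i
  k²≤m*collisions =
    subst₂ _≤_ (cong _² (trans (∑-cong (allFin n) other*#at) (∑-#at D i)))
               (cong (_* collisionsAt D i) ∑-other²)
               (cauchy-schwarz (allFin n) other (#at D i))

HitsEveryValueAt : ∀ {n} → Fin n → List (Vecₙ n) → Set
HitsEveryValueAt i D = ∀ a → Any (λ θ → lookup θ i ≡ a) D

totalAgreement≡length²⇒hits : ∀ {m} (D : List (Vecₙ (suc m))) .{{_ : NonZero (length D)}} →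
  totalAgreement D ≡ (length D) ² → HitsEveryValueAt zero D
totalAgreement≡length²⇒hits {m} D T≡k² a = ∑-𝟙≢0⇒Any (λ θ → lookup θ zero Fin.≟ a) D λ a-missing →
  ℕₚ.1+n≰n (begin
    suc (n * k ²)
      ≡⟨⟩
    (1 + k ²) + m * k ²
      ≡⟨ cong ((1 + k ²) +_) (∑-allFin-const m (k ²)) ⟨
    (1 + k ²) + (∑[ _ ∈ allFin m ] k ²)
      ≤⟨ ℕₚ.+-mono-≤ (missing-value⇒length²<n*collisionsAt D zero a a-missing)
                     (∑-mono-≤ (allFin m) (length²≤n*collisionsAt D ∘ suc)) ⟩
    n * collisionsAt D zero + (∑[ i ∈ allFin m ] n * collisionsAt D (suc i))
      ≡⟨ ∑-allFin-suc m (λ i → n * collisionsAt D i) ⟨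
    (∑[ i ∈ allFin n ] n * collisionsAt D i)
      ≡⟨ ∑-*ˡ (allFin n) n (collisionsAt D) ⟩
    n * ∑ (allFin n) (collisionsAt D)
      ≡⟨ cong (n *_) (trans (sym (totalAgreement≡∑-collisionsAt D)) T≡k²) ⟩
    n * k ² ∎)
  where
  open ℕₚ.≤-Reasoning
  n = suc m
  k = length D

foldr-⊔-lub : ∀ {a} {A : Set a} (xs : List A) (h : A → ℕ) {c} → (∀ x → h x ≤ c) → foldr _⊔_ 0 (map h xs) ≤ c
foldr-⊔-lub [] h h≤c = z≤n
foldr-⊔-lub (x ∷ xs) h h≤c = ℕₚ.⊔-lub (h≤c x) (foldr-⊔-lub xs h h≤c)

foldr-⊓-≤ : ∀ {a} {A : Set a} {xs : List A} (h : A → ℕ) b {x} → x ∈ xs → foldr _⊓_ b (map h xs) ≤ h x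
foldr-⊓-≤ h b (here refl) = ℕₚ.m⊓n≤m (h _) _
foldr-⊓-≤ {xs = y ∷ _} h b (there x∈xs) = ℕₚ.≤-trans (ℕₚ.m⊓n≤n (h y) _) (foldr-⊓-≤ h b x∈xs)

agreement-at⇒dS≤n∸1 : ∀ {n} (σ θ : Vecₙ n) i → IsPerm θ → lookup σ i ≡ lookup θ i → dS σ θ ≤ n ∸ 1
agreement-at⇒dS≤n∸1 {n} σ θ i θ-perm σi≡θi =
  subst (_≤ n ∸ 1) (sym (dS≡n∸agreements σ θ θ-perm)) (ℕₚ.∸-monoʳ-≤ n 1≤agreements)
  where
  1≤agreements : 1 ≤ agreements σ θ
  1≤agreements = subst (_≤ agreements σ θ) (𝟙-yes (lookup σ i Fin.≟ lookup θ i) σi≡θi)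
                       (∑-≥-term (∈ₚ.∈-allFin i) (λ j → 𝟙[ lookup σ j Fin.≟ lookup θ j ]))

hits⇒coveringRadius≤n∸1 : ∀ {n} (i : Fin n) (D : List (Vecₙ n)) → All IsPerm D → HitsEveryValueAt i D →
  coveringRadius D ≤ n ∸ 1
hits⇒coveringRadius≤n∸1 {n} i D D-perm hits = foldr-⊔-lub (Sym n) _ λ σ →
  let θ , θ∈D , θi≡σi = find (hits (lookup σ i))
  in ℕₚ.≤-trans (foldr-⊓-≤ (dS σ) n θ∈D) (agreement-at⇒dS≤n∸1 σ θ i (All.lookup D-perm θ∈D) (sym θi≡σi))

theorem3 : (n : ℕ) → 1 ≤ n → (D : List (Vecₙ n)) → All IsPerm D → Unique D →
    D ≢ [] → IsDesign 1 D → coveringRadius D ≤ n ∸ 1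
theorem3 (suc m) _ [] _ _ D≢[] _ = contradiction refl D≢[]
theorem3 (suc m) _ D@(_ ∷ _) D-perm _ _ design =
  hits⇒coveringRadius≤n∸1 zero D D-perm
    (totalAgreement≡length²⇒hits D (1-design⇒totalAgreement≡length² (suc m) D D-perm design))
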